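{- Let $J$ be a graph, $t$ a non-negative integer, and $P_1,\dots,P_k$ paths in $J$ with $k>\lceil 3t/2\rceil\cdot\max_{i\in[k]}|V(P_i)|$ such that for any $i\neq j\in[k]$ and any $\ell\in[\min(|V(P_i)|,|V(P_j)|)-1]$, the $\ell$-th edge of $P_i$ and the $\ell$-th edge of $P_j$ form an induced matching of $J$. Then for any tripartition $(A,B,C)$ of $V(P_1)\cup\dots\cup V(P_k)$ such that $\mathrm{sim}_J(A,B\cup C)$, $\mathrm{sim}_J(B,A\cup C)$ and $\mathrm{sim}_J(C,A\cup B)$ are all at most $t$, there exists $i\in[k]$ such that $V(P_i)$ is contained in one of $A$, $B$, $C$.
   Context: Each path $P_i$ comes with a fixed ordering of its edges from one end to the other ("$\ell$-th edge"). For disjoint $X,Y\subseteq V(J)$, $\mathrm{sim}_J(X,Y)$ is the maximum size of an induced matching of $J$ all of whose edges have one endpoint in $X$ and one in $Y$. -}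

module Defs where

open import Data.Nat using (ℕ; zero; suc; _<_; _≤_; _⊔_)
open import Data.Fin using (Fin; zero; suc; inject₁; fromℕ<)
open import Data.Product using (Σ; ∃; _×_; _,_; proj₁; proj₂)
open import Data.Sum using (_⊎_)
open import Relation.Nullary using (¬_)
open import Relation.Binary.PropositionalEquality using (_≡_; _≢_)
open import Function.Definitions using (Injective)

record Graph : Set₁ where
  field
    n       : ℕ
    Adj     : Fin n → Fin n → Set
    sym     : ∀ {x y} → Adj x y → Adj y x
    irrefl  : ∀ {x} → ¬ Adj x x

module _ (G : Graph) where
  open Graph G

  V : Set
  V = Fin n

  Apart : V → V → Set
  Apart x y = (x ≢ y) × ¬ Adj x y

  Separated : V × V → V × V → Set
  Separated (u , v) (x , y) =
    Apart u x × Apart u y × Apart v x × Apart v y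

  record InducedMatching (m : ℕ) : Set where
    field
      e₁ e₂ : Fin m → V
      isEdge : ∀ i → Adj (e₁ i) (e₂ i)
      induced : ∀ i j → i ≢ j → Separated (e₁ i , e₂ i) (e₁ j , e₂ j)

  -- sim_G(X,Y) ≤ t : every induced matching all of whose edges have one
  -- endpoint in X and the other in Y has at most t edges.
  SimAtMost : (V → Set) → (V → Set) → ℕ → Set
  SimAtMost X Y t = ∀ (m : ℕ) (M : InducedMatching m) →
    (∀ i → X (InducedMatching.e₁ M i) × Y (InducedMatching.e₂ M i)) → m ≤ t

  record Path : Set where
    field
      m      : ℕ
      vert   : Fin (suc m) → V
      inj    : Injective _≡_ _≡_ vert
      consec : ∀ (ℓ : Fin m) → Adj (vert (inject₁ ℓ)) (vert (suc ℓ))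

  nV : Path → ℕ
  nV P = suc (Path.m P)

  -- The edge of P with (0-based) index ℓ, i.e. the (ℓ+1)-th edge.
  edge : (P : Path) → Fin (Path.m P) → V × V
  edge P ℓ = Path.vert P (inject₁ ℓ) , Path.vert P (suc ℓ)

  OnPath : Path → V → Set
  OnPath P x = ∃ λ a → Path.vert P a ≡ x

maxFin : (k : ℕ) → (Fin k → ℕ) → ℕ
maxFin zero f = 0
maxFin (suc k) f = f zero ⊔ maxFin k (λ i → f (suc i))

{-# OPTIONS --safe #-}
-- Suppose no path is monochromatic. Then every path P i has an edge, its
-- ℓᵢ-th say, whose ends get different colours. Fix a level ℓ and consider
-- the paths with ℓᵢ = ℓ: their ℓ-th edges form an induced matching. Those
-- touching colour A join A to B ∪ C, so there are at most t of them, and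
-- likewise for B and C. Each edge touches exactly two colours, so twice the
-- number of these paths is at most 3t. As there are fewer than
-- max |V(P i)| levels, k ≤ ⌈3t/2⌉ · max |V(P i)|, a contradiction.
module Submission where

open import Defs
open import Data.Nat using (ℕ; _<_; _*_; ⌈_/2⌉)
open import Data.Fin using (Fin; fromℕ<)
open import Data.Product using (Σ; ∃; _×_; _,_)
open import Data.Sum using (_⊎_)
open import Relation.Nullary using (¬_)
open import Relation.Binary.PropositionalEquality using (_≢_)

open import Data.Bool using (Bool; true; false)
open import Data.Nat using (zero; suc; _+_; _≤_; z≤n; s≤s⁻¹; ⌊_/2⌋)
open import Data.Nat.Properties
open import Data.Fin using (zero; suc; inject₁; toℕ)
open import Data.Fin.Properties using (toℕ<n; fromℕ<-toℕ; ∀-cons)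
open import Data.Product using (proj₁; proj₂; swap)
open import Data.Sum using (inj₁; inj₂; [_,_]′)
open import Data.List using (List; []; _∷_; length; lookup; filter; allFin)
open import Data.List.Properties using (length-tabulate)
open import Data.List.Membership.Propositional.Properties using (∈-lookup)
open import Data.List.Relation.Unary.All as All using (All; _∷_)
import Data.List.Relation.Unary.All.Properties as Allₚ
open import Data.List.Relation.Unary.Unique.Propositional using (Unique; _∷_)
import Data.List.Relation.Unary.Unique.Propositional.Properties as Uniqueₚ
open import Function using (id; _∘_)
open import Relation.Nullary using (Dec; yes; no; does; contradiction)
open import Relation.Nullary.Decidable using (_⊎-dec_)
open import Relation.Unary using (Decidable)
open import Relation.Unary.Properties using (∁?)
open import Relation.Binary.Definitions using (DecidableEquality)
open import Relation.Binary.PropositionalEquality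
  using (_≡_; refl; sym; trans; cong; subst; ≢-sym; module ≡-Reasoning)


lookup-injective : ∀ {A : Set} {xs : List A} → Unique xs →
  ∀ i j → lookup xs i ≡ lookup xs j → i ≡ j
lookup-injective (_ ∷ _) zero zero _ = refl
lookup-injective (x∉xs ∷ _) zero (suc j) eq = contradiction eq (All.lookup x∉xs (∈-lookup j))
lookup-injective (x∉xs ∷ _) (suc i) zero eq = contradiction (sym eq) (All.lookup x∉xs (∈-lookup i))
lookup-injective (_ ∷ unique) (suc i) (suc j) eq = cong suc (lookup-injective unique i j eq)

module _ {A : Set} {P : A → Set} (P? : Decidable P) where

  length-filter+length-filter-∁ : ∀ xs →
    length (filter P? xs) + length (filter (∁? P?) xs) ≡ length xs
  length-filter+length-filter-∁ [] = refl
  length-filter+length-filter-∁ (x ∷ xs) with P? x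
  ... | yes _ = cong suc (length-filter+length-filter-∁ xs)
  ... | no _ = trans (+-suc _ _) (cong suc (length-filter+length-filter-∁ xs))

module _ {A : Set} (level : A → ℕ) {c : ℕ}
         (fibre-≤ : ∀ ℓ ys → Unique ys → All (λ y → level y ≡ ℓ) ys → length ys ≤ c) where

  length≤levels*fibre : ∀ M xs → Unique xs → All (λ x → level x < M) xs → length xs ≤ M * c
  length≤levels*fibre zero [] _ _ = z≤n
  length≤levels*fibre zero (_ ∷ _) _ (() ∷ _)
  length≤levels*fibre (suc M) xs unique below = begin
    length xs                                             ≡⟨ length-filter+length-filter-∁ at? xs ⟨
    length (filter at? xs) + length (filter (∁? at?) xs)  ≤⟨ +-mono-≤ fibre below-≤ ⟩
    c + M * c                                             ∎
    where
      open ≤-Reasoning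
      at? : Decidable (λ x → level x ≡ M)
      at? x = level x ≟ M
      fibre : length (filter at? xs) ≤ c
      fibre = fibre-≤ M _ (Uniqueₚ.filter⁺ at? unique) (Allₚ.all-filter at? xs)
      below-≤ : length (filter (∁? at?) xs) ≤ M * c
      below-≤ = length≤levels*fibre M _ (Uniqueₚ.filter⁺ (∁? at?) unique)
        (All.zipWith (λ (<1+M , ≢M) → ≤∧≢⇒< (s≤s⁻¹ <1+M) ≢M)
          (Allₚ.filter⁺ (∁? at?) below , Allₚ.all-filter (∁? at?) xs))

data TwoOfThree : Bool → Bool → Bool → Set where
  ¬₁ : TwoOfThree false true true
  ¬₂ : TwoOfThree true false true
  ¬₃ : TwoOfThree true true false

module _ {A : Set} {P Q R : A → Set} (P? : Decidable P) (Q? : Decidable Q) (R? : Decidable R)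
         (twoOfThree : ∀ x → TwoOfThree (does (P? x)) (does (Q? x)) (does (R? x))) where

  private
    a b c Σ-filters : List A → ℕ
    a xs = length (filter P? xs)
    b xs = length (filter Q? xs)
    c xs = length (filter R? xs)
    Σ-filters xs = a xs + b xs + c xs

    Σ-filters-∷ : ∀ x xs → Σ-filters (x ∷ xs) ≡ 2 + Σ-filters xs
    Σ-filters-∷ x xs with does (P? x) | does (Q? x) | does (R? x) | twoOfThree x
    ... | _ | _ | _ | ¬₁ =
      trans (+-suc (a xs + suc (b xs)) (c xs)) (cong (λ s → suc (s + c xs)) (+-suc (a xs) (b xs)))
    ... | _ | _ | _ | ¬₂ = cong suc (+-suc (a xs + b xs) (c xs))
    ... | _ | _ | _ | ¬₃ = cong (λ s → suc (s + c xs)) (+-suc (a xs) (b xs))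

  length-filter-twoOfThree : ∀ xs →
    length (filter P? xs) + length (filter Q? xs) + length (filter R? xs) ≡ length xs + length xs
  length-filter-twoOfThree [] = refl
  length-filter-twoOfThree (x ∷ xs) = begin
    Σ-filters (x ∷ xs)          ≡⟨ Σ-filters-∷ x xs ⟩
    2 + Σ-filters xs            ≡⟨ cong (2 +_) (length-filter-twoOfThree xs) ⟩
    2 + (length xs + length xs) ≡⟨ cong suc (+-suc _ _) ⟨
    suc (length xs) + suc (length xs) ∎
    where open ≡-Reasoning


constant⊎changes : ∀ {A : Set} → DecidableEquality A → ∀ {n} (f : Fin (suc n) → A) →
  (∀ a → f a ≡ f zero) ⊎ ∃ λ j → f (inject₁ j) ≢ f (suc j)
constant⊎changes _≟_ {zero} f = inj₁ λ { zero → refl }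
constant⊎changes _≟_ {suc n} f with constant⊎changes _≟_ (f ∘ suc)
... | inj₂ (j , changes) = inj₂ (suc j , changes)
... | inj₁ constant with f zero ≟ f (suc zero)
...   | no changes = inj₂ (zero , changes)
...   | yes same = inj₁ λ { zero → refl ; (suc a) → trans (constant a) (sym same) }

⊎⇒∃⊎∀ : ∀ {k} {P Q : Fin k → Set} → (∀ i → P i ⊎ Q i) → ∃ P ⊎ (∀ i → Q i)
⊎⇒∃⊎∀ {zero} _ = inj₂ λ ()
⊎⇒∃⊎∀ {suc k} p⊎q with p⊎q zero | ⊎⇒∃⊎∀ (p⊎q ∘ suc)
... | inj₁ p | _ = inj₁ (zero , p)
... | inj₂ _ | inj₁ (i , p) = inj₁ (suc i , p)
... | inj₂ q | inj₂ qs = inj₂ (∀-cons q qs)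

≤maxFin : ∀ k (f : Fin k → ℕ) i → f i ≤ maxFin k f
≤maxFin (suc k) f zero = m≤m⊔n _ _
≤maxFin (suc k) f (suc i) = ≤-trans (≤maxFin k (f ∘ suc) i) (m≤n⊔m _ _)

n+n≤m⇒n≤⌊m/2⌋ : ∀ {n m} → n + n ≤ m → n ≤ ⌊ m /2⌋
n+n≤m⇒n≤⌊m/2⌋ {n} n+n≤m = ≤-trans (≤-reflexive (n≡⌊n+n/2⌋ n)) (⌊n/2⌋-mono n+n≤m)


data Colour : Set where
  cA cB cC : Colour

_≟ᶜ_ : DecidableEquality Colour
cA ≟ᶜ cA = yes refl
cA ≟ᶜ cB = no λ ()
cA ≟ᶜ cC = no λ ()
cB ≟ᶜ cA = no λ ()
cB ≟ᶜ cB = yes refl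
cB ≟ᶜ cC = no λ ()
cC ≟ᶜ cA = no λ ()
cC ≟ᶜ cB = no λ ()
cC ≟ᶜ cC = yes refl

_∈₂_ : Colour → Colour × Colour → Set
c ∈₂ (c₁ , c₂) = c ≡ c₁ ⊎ c ≡ c₂

_∈₂?_ : ∀ c p → Dec (c ∈₂ p)
c ∈₂? (c₁ , c₂) = (c ≟ᶜ c₁) ⊎-dec (c ≟ᶜ c₂)

distinct-twoOfThree : ∀ {c₁ c₂} → c₁ ≢ c₂ →
  TwoOfThree (does (cA ∈₂? (c₁ , c₂))) (does (cB ∈₂? (c₁ , c₂))) (does (cC ∈₂? (c₁ , c₂)))
distinct-twoOfThree {cA} {cA} c₁≢c₂ = contradiction refl c₁≢c₂
distinct-twoOfThree {cA} {cB} _ = ¬₃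
distinct-twoOfThree {cA} {cC} _ = ¬₂
distinct-twoOfThree {cB} {cA} _ = ¬₃
distinct-twoOfThree {cB} {cB} c₁≢c₂ = contradiction refl c₁≢c₂
distinct-twoOfThree {cB} {cC} _ = ¬₁
distinct-twoOfThree {cC} {cA} _ = ¬₂
distinct-twoOfThree {cC} {cB} _ = ¬₁
distinct-twoOfThree {cC} {cC} c₁≢c₂ = contradiction refl c₁≢c₂

module Tricolouring {V : Set} (A B C : V → Set) where

  Class : Colour → V → Set
  Class cA = A
  Class cB = B
  Class cC = C

  Rest : Colour → V → Set
  Rest cA x = B x ⊎ C x
  Rest cB x = A x ⊎ C x
  Rest cC x = A x ⊎ B x

  class⇒rest : ∀ {c c′ x} → c ≢ c′ → Class c′ x → Rest c x
  class⇒rest {cA} {cA} c≢c′ _ = contradiction refl c≢c′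
  class⇒rest {cA} {cB} _ b = inj₁ b
  class⇒rest {cA} {cC} _ c = inj₂ c
  class⇒rest {cB} {cA} _ a = inj₁ a
  class⇒rest {cB} {cB} c≢c′ _ = contradiction refl c≢c′
  class⇒rest {cB} {cC} _ c = inj₂ c
  class⇒rest {cC} {cA} _ a = inj₁ a
  class⇒rest {cC} {cB} _ b = inj₂ b
  class⇒rest {cC} {cC} c≢c′ _ = contradiction refl c≢c′

  classify : ∀ {x} → A x ⊎ B x ⊎ C x → ∃ λ c → Class c x
  classify (inj₁ a) = cA , a
  classify (inj₂ (inj₁ b)) = cB , b
  classify (inj₂ (inj₂ c)) = cC , c

  uniform : ∀ {I : Set} {f : I → V} c → (∀ i → Class c (f i)) →
    (∀ i → A (f i)) ⊎ (∀ i → B (f i)) ⊎ (∀ i → C (f i))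
  uniform cA = inj₁
  uniform cB = inj₂ ∘ inj₁
  uniform cC = inj₂ ∘ inj₂


module _ (J : Graph) where
  open Graph J using (Adj)

  IsEdge : V J × V J → Set
  IsEdge (u , v) = Adj u v

  Crossing : (X Y : V J → Set) → V J × V J → Set
  Crossing X Y (u , v) = X u × Y v ⊎ Y u × X v

  separated-swapˡ : ∀ {e f} → Separated J e f → Separated J (swap e) f
  separated-swapˡ (ux , uy , vx , vy) = vx , vy , ux , uy

  separated-swapʳ : ∀ {e f} → Separated J e f → Separated J e (swap f)
  separated-swapʳ (ux , uy , vx , vy) = uy , ux , vy , vx

  module _ {X Y : V J → Set} where

    orient : ∀ e → Crossing X Y e → V J × V J
    orient e (inj₁ _) = e
    orient e (inj₂ _) = swap e

    orient-crossing : ∀ e h → X (proj₁ (orient e h)) × Y (proj₂ (orient e h))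
    orient-crossing e (inj₁ xy) = xy
    orient-crossing e (inj₂ yx) = swap yx

    orient-isEdge : ∀ e h → IsEdge e → IsEdge (orient e h)
    orient-isEdge e (inj₁ _) uv = uv
    orient-isEdge e (inj₂ _) uv = Graph.sym J uv

    orient-separated : ∀ e f h h′ → Separated J e f → Separated J (orient e h) (orient f h′)
    orient-separated e f (inj₁ _) (inj₁ _) = id
    orient-separated e f (inj₁ _) (inj₂ _) = separated-swapʳ
    orient-separated e f (inj₂ _) (inj₁ _) = separated-swapˡ
    orient-separated e f (inj₂ _) (inj₂ _) = separated-swapˡ ∘ separated-swapʳ

    crossing-≤ : ∀ {t m} → SimAtMost J X Y t → (e : Fin m → V J × V J) →
      (∀ i → IsEdge (e i)) → (∀ i j → i ≢ j → Separated J (e i) (e j)) →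
      (∀ i → Crossing X Y (e i)) → m ≤ t
    crossing-≤ {m = m} sim e isEdge separated crossing =
      sim m matching λ i → orient-crossing (e i) (crossing i)
      where
        oriented : Fin m → V J × V J
        oriented i = orient (e i) (crossing i)
        matching : InducedMatching J m
        matching = record
          { e₁ = proj₁ ∘ oriented
          ; e₂ = proj₂ ∘ oriented
          ; isEdge = λ i → orient-isEdge (e i) (crossing i) (isEdge i)
          ; induced = λ i j i≢j →
              orient-separated (e i) (e j) (crossing i) (crossing j) (separated i j i≢j)
          }


module _ (J : Graph) {k : ℕ} (P : Fin k → Path J) where

  SameIndexSeparated : Set
  SameIndexSeparated = ∀ (i j : Fin k) → i ≢ j → ∀ (ℓ : ℕ) (p : ℓ < Path.m (P i)) (q : ℓ < Path.m (P j)) →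
    Separated J (edge J (P i) (fromℕ< p)) (edge J (P j) (fromℕ< q))

  CrossesAt : (X Y : V J → Set) → ℕ → Fin k → Set
  CrossesAt X Y ℓ i = Σ (ℓ < Path.m (P i)) λ p → Crossing J X Y (edge J (P i) (fromℕ< p))

  crossesAt-toℕ : ∀ {X Y i} (j : Fin (Path.m (P i))) →
    Crossing J X Y (edge J (P i) j) → CrossesAt X Y (toℕ j) i
  crossesAt-toℕ {X} {Y} {i} j crossing =
    toℕ<n j , subst (Crossing J X Y ∘ edge J (P i)) (sym (fromℕ<-toℕ j (toℕ<n j))) crossing

  crossingPaths-≤ : ∀ {X Y t} → SameIndexSeparated → SimAtMost J X Y t →
    ∀ ℓ {zs} → Unique zs → All (CrossesAt X Y ℓ) zs → length zs ≤ t
  crossingPaths-≤ {X} {Y} separated sim ℓ {zs} unique crosses =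
    crossing-≤ J {X} {Y} sim e (λ i → Path.consec (P (lookup zs i)) _) e-separated (proj₂ ∘ at)
    where
      at : ∀ i → CrossesAt X Y ℓ (lookup zs i)
      at i = All.lookup crosses (∈-lookup i)
      e : Fin (length zs) → V J × V J
      e i = edge J (P (lookup zs i)) (fromℕ< (proj₁ (at i)))
      e-separated : ∀ i j → i ≢ j → Separated J (e i) (e j)
      e-separated i j i≢j = separated (lookup zs i) (lookup zs j) (i≢j ∘ lookup-injective unique i j)
        ℓ (proj₁ (at i)) (proj₁ (at j))


module _ (J : Graph) {k : ℕ} (P : Fin k → Path J) (A B C : V J → Set) where
  open Tricolouring A B C

  record BichromaticEdge (i : Fin k) : Set where
    field
      index : Fin (Path.m (P i))
      c₁ c₂ : Colour
      distinct : c₁ ≢ c₂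
      ends : Class c₁ (proj₁ (edge J (P i) index)) × Class c₂ (proj₂ (edge J (P i) index))

  open BichromaticEdge

  touching⇒crossesAt : ∀ {i c} (β : BichromaticEdge i) → c ∈₂ (c₁ β , c₂ β) →
    CrossesAt J P (Class c) (Rest c) (toℕ (index β)) i
  touching⇒crossesAt β (inj₁ refl) = crossesAt-toℕ J P {Class (c₁ β)} {Rest (c₁ β)} (index β)
    (inj₁ (proj₁ (ends β) , class⇒rest (distinct β) (proj₂ (ends β))))
  touching⇒crossesAt β (inj₂ refl) = crossesAt-toℕ J P {Class (c₂ β)} {Rest (c₂ β)} (index β)
    (inj₂ (class⇒rest (≢-sym (distinct β)) (proj₁ (ends β)) , proj₂ (ends β)))

  monochromatic⊎bichromatic : (∀ x → (∃ λ i → OnPath J (P i) x) → A x ⊎ B x ⊎ C x) → ∀ i →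
    ((∀ a → A (Path.vert (P i) a)) ⊎ (∀ a → B (Path.vert (P i) a)) ⊎ (∀ a → C (Path.vert (P i) a)))
    ⊎ BichromaticEdge i
  monochromatic⊎bichromatic coloured i =
    [ inj₁ ∘ monochromatic , inj₂ ∘ bichromatic ]′ (constant⊎changes _≟ᶜ_ colour)
    where
      vert : Fin (suc (Path.m (P i))) → V J
      vert = Path.vert (P i)
      classified : ∀ a → ∃ λ c → Class c (vert a)
      classified a = classify (coloured (vert a) (i , a , refl))
      colour : Fin (suc (Path.m (P i))) → Colour
      colour = proj₁ ∘ classified
      monochromatic : (∀ a → colour a ≡ colour zero) →
        (∀ a → A (vert a)) ⊎ (∀ a → B (vert a)) ⊎ (∀ a → C (vert a))
      monochromatic same = uniform (colour zero) λ a →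
        subst (λ c → Class c (vert a)) (same a) (proj₂ (classified a))
      bichromatic : ∃ (λ j → colour (inject₁ j) ≢ colour (suc j)) → BichromaticEdge i
      bichromatic (j , changes) = record
        { index = j ; c₁ = colour (inject₁ j) ; c₂ = colour (suc j) ; distinct = changes
        ; ends = proj₂ (classified (inject₁ j)) , proj₂ (classified (suc j)) }

  module _ (separated : SameIndexSeparated J P) {t : ℕ}
           (sim : ∀ c → SimAtMost J (Class c) (Rest c) t)
           (β : ∀ i → BichromaticEdge i) where

    level : Fin k → ℕ
    level i = toℕ (index (β i))

    touches? : ∀ c → Decidable (λ i → c ∈₂ (c₁ (β i) , c₂ (β i)))
    touches? c i = c ∈₂? (c₁ (β i) , c₂ (β i))

    touching-≤ : ∀ c ℓ ys → Unique ys → All (λ i → level i ≡ ℓ) ys → length (filter (touches? c) ys) ≤ t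
    touching-≤ c ℓ ys unique atℓ = crossingPaths-≤ J P {Class c} {Rest c} separated (sim c) ℓ
      (Uniqueₚ.filter⁺ (touches? c) unique)
      (All.zipWith crossesAtℓ (Allₚ.filter⁺ (touches? c) atℓ , Allₚ.all-filter (touches? c) ys))
      where
        crossesAtℓ : ∀ {i} → level i ≡ ℓ × c ∈₂ (c₁ (β i) , c₂ (β i)) → CrossesAt J P (Class c) (Rest c) ℓ i
        crossesAtℓ (refl , touching) = touching⇒crossesAt (β _) touching

    sameLevel-≤ : ∀ ℓ ys → Unique ys → All (λ i → level i ≡ ℓ) ys → length ys ≤ ⌈ 3 * t /2⌉
    sameLevel-≤ ℓ ys unique atℓ = ≤-trans (n+n≤m⇒n≤⌊m/2⌋ twice-≤) (⌊n/2⌋≤⌈n/2⌉ (3 * t))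
      where
        open ≤-Reasoning
        count : Colour → ℕ
        count c = length (filter (touches? c) ys)
        twice-≤ : length ys + length ys ≤ 3 * t
        twice-≤ = begin
          length ys + length ys  ≡⟨ length-filter-twoOfThree (touches? cA) (touches? cB) (touches? cC)
                                      (distinct-twoOfThree ∘ distinct ∘ β) ys ⟨
          count cA + count cB + count cC
            ≤⟨ +-mono-≤ (+-mono-≤ (touching-≤ cA ℓ ys unique atℓ) (touching-≤ cB ℓ ys unique atℓ))
                        (touching-≤ cC ℓ ys unique atℓ) ⟩
          t + t + t              ≡⟨ cong (t + t +_) (+-identityʳ t) ⟨
          t + t + (t + 0)        ≡⟨ +-assoc t t (t + 0) ⟩
          3 * t                  ∎

    bichromatic-≤ : k ≤ ⌈ 3 * t /2⌉ * maxFin k (λ i → nV J (P i))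
    bichromatic-≤ = begin
      k                       ≡⟨ length-tabulate id ⟨
      length (allFin k)       ≤⟨ length≤levels*fibre level sameLevel-≤ M (allFin k)
                                   (Uniqueₚ.allFin⁺ k) (Allₚ.tabulate⁺ level<M) ⟩
      M * ⌈ 3 * t /2⌉         ≡⟨ *-comm M _ ⟩
      ⌈ 3 * t /2⌉ * M         ∎
      where
        open ≤-Reasoning
        M : ℕ
        M = maxFin k (λ i → nV J (P i))
        level<M : ∀ i → level i < M
        level<M i = <-≤-trans (toℕ<n (index (β i))) (≤-trans (n≤1+n _) (≤maxFin k (λ i → nV J (P i)) i))


lemma28 : (J : Graph) (t k : ℕ) (P : Fin k → Path J) →
    ⌈ 3 * t /2⌉ * maxFin k (λ i → nV J (P i)) < k →
    (∀ (i j : Fin k) → i ≢ j → ∀ (ℓ : ℕ) (p : ℓ < Path.m (P i)) (q : ℓ < Path.m (P j)) →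
      Separated J (edge J (P i) (fromℕ< p)) (edge J (P j) (fromℕ< q))) →
    (A B C : V J → Set) →
    (∀ x → A x → ∃ λ i → OnPath J (P i) x) →
    (∀ x → B x → ∃ λ i → OnPath J (P i) x) →
    (∀ x → C x → ∃ λ i → OnPath J (P i) x) →
    (∀ x → (∃ λ i → OnPath J (P i) x) → A x ⊎ B x ⊎ C x) →
    (∀ x → ¬ (A x × B x)) → (∀ x → ¬ (A x × C x)) → (∀ x → ¬ (B x × C x)) →
    SimAtMost J A (λ x → B x ⊎ C x) t →
    SimAtMost J B (λ x → A x ⊎ C x) t →
    SimAtMost J C (λ x → A x ⊎ B x) t →
    ∃ λ i → (∀ a → A (Path.vert (P i) a)) ⊎ (∀ a → B (Path.vert (P i) a)) ⊎ (∀ a → C (Path.vert (P i) a))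
lemma28 J t k P k-large separated A B C _ _ _ coloured _ _ _ simA simB simC =
  [ id , (λ β → contradiction (bichromatic-≤ J P A B C separated sim β) (<⇒≱ k-large)) ]′
    (⊎⇒∃⊎∀ (monochromatic⊎bichromatic J P A B C coloured))
  where
    open Tricolouring A B C
    sim : ∀ c → SimAtMost J (Class c) (Rest c) t
    sim cA = simA
    sim cB = simB
    sim cC = simC
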